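{- For every set $\Gamma\cup\{A\}\subseteq\mathsf{Form}_Q$: if $\Gamma\vdash_{i3}A$ then $f(\Gamma)\vdash_r f(A)$, where $f(\Gamma)=\{f(B):B\in\Gamma\}$.
   Context: $\mathcal{L}_Q$: first-order language with $\bot,{\sim},\land,\lor,\to,\forall,\exists$, countably many constants, variables and predicate symbols; $\mathsf{Form}_Q$ its formulas; $\neg A:=A\to\bot$, $A\leftrightarrow B:=(A\to B)\land(B\to A)$. $\mathbf{QBDi3}$ is the Hilbert system with axioms (Ax1) $A\to(B\to A)$; (Ax2) $(A\to(B\to C))\to((A\to B)\to(A\to C))$; (Ax4) $(A\land B)\to A$; (Ax5) $(A\land B)\to B$; (Ax6) $(C\to A)\to((C\to B)\to(C\to(A\land B)))$; (Ax7) $A\to(A\lor B)$; (Ax8) $B\to(A\lor B)$; (Ax9) $(A\to C)\to((B\to C)\to((A\lor B)\to C))$; (Ax10) $\bot\to A$; (Ax11) $A(t)\to\exists xA$; (Ax12) $\forall x(A(x)\to B)\to(\exists xA(x)\to B)$ ($x$ not free in $B$); (Ax13) $\forall x(B\to A)\to(B\to\forall xA)$ ($x$ not free in $B$); (Ax14) $\forall xA\to A(t)$; (Ax15) $A\to{\sim}\bot$; (Ax16) ${\sim}{\sim}A\leftrightarrow A$; (Ax17) ${\sim}(A\land B)\leftrightarrow({\sim}A\lor{\sim}B)$; (Ax18) ${\sim}(A\lor B)\leftrightarrow({\sim}A\land{\sim}B)$; (Ax19) ${\sim}(A\to B)\leftrightarrow(\neg{\sim}A\land{\sim}B)$; (Ax20)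 ${\sim}\forall xA\leftrightarrow\exists x{\sim}A$; (Ax21) ${\sim}\exists xA\leftrightarrow\forall x{\sim}A$; (i1) $\forall x\neg\neg A\to\neg\neg\forall xA$; (i2) ${\sim}A\to\neg A$; (i3) $\neg\neg(A\lor{\sim}A)$; rules MP and Gen (from $A$ infer $\forall xA$). $\Gamma\vdash_{i3}A$: there is a finite list ending in $A$ each item of which is in $\Gamma$, an axiom instance, or follows from earlier items by MP or Gen. The reduction $f:\mathsf{Form}_Q\to\mathsf{Form}_Q$: $f(P)=P$ and $f({\sim}P)={\sim}P$ for atomic $P$; $f(\bot)=\bot$, $f({\sim}\bot)={\sim}\bot$; $f(A\circ B)=f(A)\circ f(B)$ for $\circ\in\{\land,\lor,\to\}$; $f(QxA)=Qxf(A)$ for $Q\in\{\forall,\exists\}$; $f({\sim}{\sim}A)=f(A)$; $f({\sim}(A\land B))=f({\sim}A)\lor f({\sim}B)$; $f({\sim}(A\lor B))=f({\sim}A)\land f({\sim}B)$; $f({\sim}(A\to B))=\neg f({\sim}A)\land f({\sim}B)$; $f({\sim}\forall xA)=\exists xf({\sim}A)$; $f({\sim}\exists xA)=\forall xf({\sim}A)$. A formula is reduced if it is of the form $f(B)$ for some $B$. $\Delta\vdash_r C$ means there is a $\mathbf{QBDi3}$-derivation of $C$ from $\Delta$ in which every formula is reduced. -}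

module Defs where

open import Data.Nat using (ℕ; _≟_)
open import Data.List using (List)
open import Data.List.Relation.Unary.Any using (Any)
open import Data.Product using (Σ; _×_)
open import Relation.Binary.PropositionalEquality using (_≡_)
open import Relation.Nullary using (¬_; yes; no)

Var : Set
Var = ℕ

data Term : Set where
  var   : Var → Term
  const : ℕ → Term

infixr 5 _⇒_
infixr 6 _∨′_
infixr 7 _∧′_
data Form : Set where
  pred : ℕ → List Term → Form
  ⊥′   : Form
  ∼_   : Form → Form
  _∧′_ : Form → Form → Form
  _∨′_ : Form → Form → Form
  _⇒_  : Form → Form → Form
  ∀′   : Var → Form → Form
  ∃′   : Var → Form → Form

¬′_ : Form → Form
¬′ A = A ⇒ ⊥′

_⇔_ : Form → Form → Form
A ⇔ B = (A ⇒ B) ∧′ (B ⇒ A)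

data FreeT (x : Var) : Term → Set where
  here : FreeT x (var x)

data Free (x : Var) : Form → Set where
  fpred : ∀ {p ts} → Any (FreeT x) ts → Free x (pred p ts)
  f∼    : ∀ {A} → Free x A → Free x (∼ A)
  f∧l   : ∀ {A B} → Free x A → Free x (A ∧′ B)
  f∧r   : ∀ {A B} → Free x B → Free x (A ∧′ B)
  f∨l   : ∀ {A B} → Free x A → Free x (A ∨′ B)
  f∨r   : ∀ {A B} → Free x B → Free x (A ∨′ B)
  f⇒l   : ∀ {A B} → Free x A → Free x (A ⇒ B)
  f⇒r   : ∀ {A B} → Free x B → Free x (A ⇒ B)
  f∀    : ∀ {y A} → ¬ (x ≡ y) → Free x A → Free x (∀′ y A)
  f∃    : ∀ {y A} → ¬ (x ≡ y) → Free x A → Free x (∃′ y A)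

substT : Var → Term → Term → Term
substT x t (var y) with x ≟ y
... | yes _ = t
... | no _  = var y
substT x t (const c) = const c

substTs : Var → Term → List Term → List Term
substTs x t List.[] = List.[]
substTs x t (s List.∷ ss) = substT x t s List.∷ substTs x t ss

subst : Var → Term → Form → Form
subst x t (pred p ts) = pred p (substTs x t ts)
subst x t ⊥′ = ⊥′
subst x t (∼ A) = ∼ subst x t A
subst x t (A ∧′ B) = subst x t A ∧′ subst x t B
subst x t (A ∨′ B) = subst x t A ∨′ subst x t B
subst x t (A ⇒ B) = subst x t A ⇒ subst x t B
subst x t (∀′ y A) with x ≟ y
... | yes _ = ∀′ y A
... | no _  = ∀′ y (subst x t A)
subst x t (∃′ y A) with x ≟ y
... | yes _ = ∃′ y A
... | no _  = ∃′ y (subst x t A)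

VarOf : Var → Term → Set
VarOf y t = t ≡ var y

data FreeFor (t : Term) (x : Var) : Form → Set where
  ffpred : ∀ {p ts} → FreeFor t x (pred p ts)
  ff⊥    : FreeFor t x ⊥′
  ff∼    : ∀ {A} → FreeFor t x A → FreeFor t x (∼ A)
  ff∧    : ∀ {A B} → FreeFor t x A → FreeFor t x B → FreeFor t x (A ∧′ B)
  ff∨    : ∀ {A B} → FreeFor t x A → FreeFor t x B → FreeFor t x (A ∨′ B)
  ff⇒    : ∀ {A B} → FreeFor t x A → FreeFor t x B → FreeFor t x (A ⇒ B)
  ff∀    : ∀ {y A} → ¬ Free x (∀′ y A) → FreeFor t x (∀′ y A)
  ff∀′   : ∀ {y A} → ¬ VarOf y t → FreeFor t x A → FreeFor t x (∀′ y A)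
  ff∃    : ∀ {y A} → ¬ Free x (∃′ y A) → FreeFor t x (∃′ y A)
  ff∃′   : ∀ {y A} → ¬ VarOf y t → FreeFor t x A → FreeFor t x (∃′ y A)

data Axiom : Form → Set where
  ax1  : ∀ A B → Axiom (A ⇒ (B ⇒ A))
  ax2  : ∀ A B C → Axiom ((A ⇒ (B ⇒ C)) ⇒ ((A ⇒ B) ⇒ (A ⇒ C)))
  ax4  : ∀ A B → Axiom ((A ∧′ B) ⇒ A)
  ax5  : ∀ A B → Axiom ((A ∧′ B) ⇒ B)
  ax6  : ∀ A B C → Axiom ((C ⇒ A) ⇒ ((C ⇒ B) ⇒ (C ⇒ (A ∧′ B))))
  ax7  : ∀ A B → Axiom (A ⇒ (A ∨′ B))
  ax8  : ∀ A B → Axiom (B ⇒ (A ∨′ B))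
  ax9  : ∀ A B C → Axiom ((A ⇒ C) ⇒ ((B ⇒ C) ⇒ ((A ∨′ B) ⇒ C)))
  ax10 : ∀ A → Axiom (⊥′ ⇒ A)
  ax11 : ∀ x t A → FreeFor t x A → Axiom (subst x t A ⇒ ∃′ x A)
  ax12 : ∀ x A B → ¬ Free x B → Axiom (∀′ x (A ⇒ B) ⇒ (∃′ x A ⇒ B))
  ax13 : ∀ x A B → ¬ Free x B → Axiom (∀′ x (B ⇒ A) ⇒ (B ⇒ ∀′ x A))
  ax14 : ∀ x t A → FreeFor t x A → Axiom (∀′ x A ⇒ subst x t A)
  ax15 : ∀ A → Axiom (A ⇒ ∼ ⊥′)
  ax16 : ∀ A → Axiom ((∼ ∼ A) ⇔ A)
  ax17 : ∀ A B → Axiom ((∼ (A ∧′ B)) ⇔ (∼ A ∨′ ∼ B))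
  ax18 : ∀ A B → Axiom ((∼ (A ∨′ B)) ⇔ (∼ A ∧′ ∼ B))
  ax19 : ∀ A B → Axiom ((∼ (A ⇒ B)) ⇔ ((¬′ (∼ A)) ∧′ ∼ B))
  ax20 : ∀ x A → Axiom ((∼ ∀′ x A) ⇔ ∃′ x (∼ A))
  ax21 : ∀ x A → Axiom ((∼ ∃′ x A) ⇔ ∀′ x (∼ A))
  i1   : ∀ x A → Axiom (∀′ x (¬′ ¬′ A) ⇒ (¬′ ¬′ ∀′ x A))
  i2   : ∀ A → Axiom (∼ A ⇒ ¬′ A)
  i3   : ∀ A → Axiom (¬′ ¬′ (A ∨′ ∼ A))

-- Derivations from a set Γ (a predicate on formulas) in which every formula
-- occurring satisfies the predicate P (tree form of Hilbert derivations).
data Deriv (P : Form → Set) (Γ : Form → Set) : Form → Set where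
  hyp : ∀ {A} → P A → Γ A → Deriv P Γ A
  ax  : ∀ {A} → P A → Axiom A → Deriv P Γ A
  mp  : ∀ {A B} → P B → Deriv P Γ A → Deriv P Γ (A ⇒ B) → Deriv P Γ B
  gen : ∀ {A} x → P (∀′ x A) → Deriv P Γ A → Deriv P Γ (∀′ x A)

_⊢i3_ : (Form → Set) → Form → Set
Γ ⊢i3 A = Deriv (λ _ → Data.Unit.⊤) Γ A
  where import Data.Unit

-- The reduction f; fneg A stands for f(∼A).
mutual
  f : Form → Form
  f (pred p ts) = pred p ts
  f ⊥′ = ⊥′
  f (∼ A) = fneg A
  f (A ∧′ B) = f A ∧′ f B
  f (A ∨′ B) = f A ∨′ f B
  f (A ⇒ B) = f A ⇒ f B
  f (∀′ x A) = ∀′ x (f A)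
  f (∃′ x A) = ∃′ x (f A)

  fneg : Form → Form
  fneg (pred p ts) = ∼ pred p ts
  fneg ⊥′ = ∼ ⊥′
  fneg (∼ A) = f A
  fneg (A ∧′ B) = fneg A ∨′ fneg B
  fneg (A ∨′ B) = fneg A ∧′ fneg B
  fneg (A ⇒ B) = (¬′ fneg A) ∧′ fneg B
  fneg (∀′ x A) = ∃′ x (fneg A)
  fneg (∃′ x A) = ∀′ x (fneg A)

Reduced : Form → Set
Reduced C = Σ Form (λ B → f B ≡ C)

_⊢r_ : (Form → Set) → Form → Set
Δ ⊢r C = Deriv Reduced Δ C

fImage : (Form → Set) → Form → Set
fImage Γ C = Σ Form (λ B → Γ B × f B ≡ C)

-- A derivation is translated step by step: f commutes with substitution and
-- never creates free variables, so every axiom goes to an instance of the same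
-- scheme, except that f collapses the two sides of Ax16–Ax21 (they become
-- C ↔ C) and sends i2, i3 for a compound formula to statements that are not
-- axioms.  Those are derived by induction on the formula from the instances
-- for its immediate subformulas (with i1 at the quantifiers), reasoning only
-- about f-images so that every intermediate formula is reduced.
module Submission where

open import Defs
open import Data.Nat using (_≟_)
open import Data.List using (List; []; _∷_)
open import Data.List.Relation.Unary.All using (All; []; _∷_)
open import Data.Product using (_,_)
open import Relation.Binary.PropositionalEquality using (_≡_; refl; cong; cong₂; sym)
import Relation.Binary.PropositionalEquality as ≡
open import Relation.Nullary using (¬_; yes; no)

∀-binds : ∀ {y A} → ¬ Free y (∀′ y A)
∀-binds (f∀ y≢y _) = y≢y refl

∃-binds : ∀ {y A} → ¬ Free y (∃′ y A)
∃-binds (f∃ y≢y _) = y≢y refl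

mutual
  free-f⇒free : ∀ {x} A → Free x (f A) → Free x A
  free-f⇒free (pred p ts) q = q
  free-f⇒free (∼ A) q = f∼ (free-fneg⇒free A q)
  free-f⇒free (A ∧′ B) (f∧l q) = f∧l (free-f⇒free A q)
  free-f⇒free (A ∧′ B) (f∧r q) = f∧r (free-f⇒free B q)
  free-f⇒free (A ∨′ B) (f∨l q) = f∨l (free-f⇒free A q)
  free-f⇒free (A ∨′ B) (f∨r q) = f∨r (free-f⇒free B q)
  free-f⇒free (A ⇒ B) (f⇒l q) = f⇒l (free-f⇒free A q)
  free-f⇒free (A ⇒ B) (f⇒r q) = f⇒r (free-f⇒free B q)
  free-f⇒free (∀′ y A) (f∀ x≢y q) = f∀ x≢y (free-f⇒free A q)
  free-f⇒free (∃′ y A) (f∃ x≢y q) = f∃ x≢y (free-f⇒free A q)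

  free-fneg⇒free : ∀ {x} A → Free x (fneg A) → Free x A
  free-fneg⇒free (pred p ts) (f∼ q) = q
  free-fneg⇒free ⊥′ (f∼ ())
  free-fneg⇒free (∼ A) q = f∼ (free-f⇒free A q)
  free-fneg⇒free (A ∧′ B) (f∨l q) = f∧l (free-fneg⇒free A q)
  free-fneg⇒free (A ∧′ B) (f∨r q) = f∧r (free-fneg⇒free B q)
  free-fneg⇒free (A ∨′ B) (f∧l q) = f∨l (free-fneg⇒free A q)
  free-fneg⇒free (A ∨′ B) (f∧r q) = f∨r (free-fneg⇒free B q)
  free-fneg⇒free (A ⇒ B) (f∧l (f⇒l q)) = f⇒l (free-fneg⇒free A q)
  free-fneg⇒free (A ⇒ B) (f∧r q) = f⇒r (free-fneg⇒free B q)
  free-fneg⇒free (∀′ y A) (f∃ x≢y q) = f∀ x≢y (free-fneg⇒free A q)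
  free-fneg⇒free (∃′ y A) (f∀ x≢y q) = f∃ x≢y (free-fneg⇒free A q)

mutual
  freeFor⇒freeFor-f : ∀ {t x} A → FreeFor t x A → FreeFor t x (f A)
  freeFor⇒freeFor-f (pred p ts) ok = ok
  freeFor⇒freeFor-f ⊥′ ok = ok
  freeFor⇒freeFor-f (∼ A) (ff∼ ok) = freeFor⇒freeFor-fneg A ok
  freeFor⇒freeFor-f (A ∧′ B) (ff∧ okA okB) = ff∧ (freeFor⇒freeFor-f A okA) (freeFor⇒freeFor-f B okB)
  freeFor⇒freeFor-f (A ∨′ B) (ff∨ okA okB) = ff∨ (freeFor⇒freeFor-f A okA) (freeFor⇒freeFor-f B okB)
  freeFor⇒freeFor-f (A ⇒ B) (ff⇒ okA okB) = ff⇒ (freeFor⇒freeFor-f A okA) (freeFor⇒freeFor-f B okB)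
  freeFor⇒freeFor-f (∀′ y A) (ff∀ nf) = ff∀ (λ q → nf (free-f⇒free (∀′ y A) q))
  freeFor⇒freeFor-f (∀′ y A) (ff∀′ t∌y ok) = ff∀′ t∌y (freeFor⇒freeFor-f A ok)
  freeFor⇒freeFor-f (∃′ y A) (ff∃ nf) = ff∃ (λ q → nf (free-f⇒free (∃′ y A) q))
  freeFor⇒freeFor-f (∃′ y A) (ff∃′ t∌y ok) = ff∃′ t∌y (freeFor⇒freeFor-f A ok)

  freeFor⇒freeFor-fneg : ∀ {t x} A → FreeFor t x A → FreeFor t x (fneg A)
  freeFor⇒freeFor-fneg (pred p ts) ok = ff∼ ok
  freeFor⇒freeFor-fneg ⊥′ ok = ff∼ ok
  freeFor⇒freeFor-fneg (∼ A) (ff∼ ok) = freeFor⇒freeFor-f A ok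
  freeFor⇒freeFor-fneg (A ∧′ B) (ff∧ okA okB) = ff∨ (freeFor⇒freeFor-fneg A okA) (freeFor⇒freeFor-fneg B okB)
  freeFor⇒freeFor-fneg (A ∨′ B) (ff∨ okA okB) = ff∧ (freeFor⇒freeFor-fneg A okA) (freeFor⇒freeFor-fneg B okB)
  freeFor⇒freeFor-fneg (A ⇒ B) (ff⇒ okA okB) = ff∧ (ff⇒ (freeFor⇒freeFor-fneg A okA) ff⊥) (freeFor⇒freeFor-fneg B okB)
  freeFor⇒freeFor-fneg (∀′ y A) (ff∀ nf) = ff∃ (λ q → nf (free-fneg⇒free (∀′ y A) q))
  freeFor⇒freeFor-fneg (∀′ y A) (ff∀′ t∌y ok) = ff∃′ t∌y (freeFor⇒freeFor-fneg A ok)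
  freeFor⇒freeFor-fneg (∃′ y A) (ff∃ nf) = ff∀ (λ q → nf (free-fneg⇒free (∃′ y A) q))
  freeFor⇒freeFor-fneg (∃′ y A) (ff∃′ t∌y ok) = ff∀′ t∌y (freeFor⇒freeFor-fneg A ok)

mutual
  f-subst : ∀ x t A → f (subst x t A) ≡ subst x t (f A)
  f-subst x t (pred p ts) = refl
  f-subst x t ⊥′ = refl
  f-subst x t (∼ A) = fneg-subst x t A
  f-subst x t (A ∧′ B) = cong₂ _∧′_ (f-subst x t A) (f-subst x t B)
  f-subst x t (A ∨′ B) = cong₂ _∨′_ (f-subst x t A) (f-subst x t B)
  f-subst x t (A ⇒ B) = cong₂ _⇒_ (f-subst x t A) (f-subst x t B)
  f-subst x t (∀′ y A) with x ≟ y
  ... | yes _ = refl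
  ... | no _ = cong (∀′ y) (f-subst x t A)
  f-subst x t (∃′ y A) with x ≟ y
  ... | yes _ = refl
  ... | no _ = cong (∃′ y) (f-subst x t A)

  fneg-subst : ∀ x t A → fneg (subst x t A) ≡ subst x t (fneg A)
  fneg-subst x t (pred p ts) = refl
  fneg-subst x t ⊥′ = refl
  fneg-subst x t (∼ A) = f-subst x t A
  fneg-subst x t (A ∧′ B) = cong₂ _∨′_ (fneg-subst x t A) (fneg-subst x t B)
  fneg-subst x t (A ∨′ B) = cong₂ _∧′_ (fneg-subst x t A) (fneg-subst x t B)
  fneg-subst x t (A ⇒ B) = cong₂ (λ a b → ¬′ a ∧′ b) (fneg-subst x t A) (fneg-subst x t B)
  fneg-subst x t (∀′ y A) with x ≟ y
  ... | yes _ = refl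
  ... | no _ = cong (∃′ y) (fneg-subst x t A)
  fneg-subst x t (∃′ y A) with x ≟ y
  ... | yes _ = refl
  ... | no _ = cong (∀′ y) (fneg-subst x t A)

substT-self : ∀ x s → substT x (var x) s ≡ s
substT-self x (var y) with x ≟ y
... | yes x≡y = cong var x≡y
... | no _ = refl
substT-self x (const c) = refl

substTs-self : ∀ x ss → substTs x (var x) ss ≡ ss
substTs-self x [] = refl
substTs-self x (s ∷ ss) = cong₂ _∷_ (substT-self x s) (substTs-self x ss)

subst-self : ∀ x A → subst x (var x) A ≡ A
subst-self x (pred p ts) = cong (pred p) (substTs-self x ts)
subst-self x ⊥′ = refl
subst-self x (∼ A) = cong ∼_ (subst-self x A)
subst-self x (A ∧′ B) = cong₂ _∧′_ (subst-self x A) (subst-self x B)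
subst-self x (A ∨′ B) = cong₂ _∨′_ (subst-self x A) (subst-self x B)
subst-self x (A ⇒ B) = cong₂ _⇒_ (subst-self x A) (subst-self x B)
subst-self x (∀′ y A) with x ≟ y
... | yes _ = refl
... | no _ = cong (∀′ y) (subst-self x A)
subst-self x (∃′ y A) with x ≟ y
... | yes _ = refl
... | no _ = cong (∃′ y) (subst-self x A)

freeFor-self : ∀ x A → FreeFor (var x) x A
freeFor-self x (pred p ts) = ffpred
freeFor-self x ⊥′ = ff⊥
freeFor-self x (∼ A) = ff∼ (freeFor-self x A)
freeFor-self x (A ∧′ B) = ff∧ (freeFor-self x A) (freeFor-self x B)
freeFor-self x (A ∨′ B) = ff∨ (freeFor-self x A) (freeFor-self x B)
freeFor-self x (A ⇒ B) = ff⇒ (freeFor-self x A) (freeFor-self x B)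
freeFor-self x (∀′ y A) with x ≟ y
... | yes refl = ff∀ ∀-binds
... | no x≢y = ff∀′ (λ { refl → x≢y refl }) (freeFor-self x A)
freeFor-self x (∃′ y A) with x ≟ y
... | yes refl = ff∃ ∃-binds
... | no x≢y = ff∃′ (λ { refl → x≢y refl }) (freeFor-self x A)

infixr 4 _⇛_
_⇛_ : List Form → Form → Form
[] ⇛ C = C
(H ∷ Δ) ⇛ C = Δ ⇛ (H ⇒ C)

-- A natural-deduction layer over reduced Hilbert derivations.  Its judgements
-- are indexed by source formulas X and derive f X, so every formula in a
-- derivation is reduced with the trivial witness (X , refl).
module ReducedCalculus (Γ : Form → Set) where

  infix 2 _⊩_
  record _⊩_ (Δ : List Form) (C : Form) : Set where
    constructor ⟨_⟩
    field derivation : Deriv Reduced Γ (f (Δ ⇛ C))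
  open _⊩_ public

  retype : ∀ {X Y} → f X ≡ f Y → [] ⊩ X → [] ⊩ Y
  retype fX≡fY ⟨ d ⟩ = ⟨ ≡.subst (Deriv Reduced Γ) fX≡fY d ⟩

  axiom : ∀ {X} → Axiom (f X) → [] ⊩ X
  axiom {X} a = ⟨ ax (X , refl) a ⟩

  ⇒-elim₀ : ∀ {X Y} → [] ⊩ (X ⇒ Y) → [] ⊩ X → [] ⊩ Y
  ⇒-elim₀ {Y = Y} ⟨ d ⟩ ⟨ e ⟩ = ⟨ mp (Y , refl) e d ⟩

  K : ∀ {X Y} → [] ⊩ (X ⇒ (Y ⇒ X))
  K {X} {Y} = axiom (ax1 (f X) (f Y))

  S : ∀ {X Y Z} → [] ⊩ ((X ⇒ (Y ⇒ Z)) ⇒ ((X ⇒ Y) ⇒ (X ⇒ Z)))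
  S {X} {Y} {Z} = axiom (ax2 (f X) (f Y) (f Z))

  I : ∀ {X} → [] ⊩ (X ⇒ X)
  I {X} = ⇒-elim₀ (⇒-elim₀ (S {X} {X ⇒ X} {X}) K) (K {X} {X})

  ⇒-intro : ∀ {Δ H C} → (H ∷ Δ) ⊩ C → Δ ⊩ (H ⇒ C)
  ⇒-intro ⟨ d ⟩ = ⟨ d ⟩

  ⇒-intro⁻¹ : ∀ {Δ H C} → Δ ⊩ (H ⇒ C) → (H ∷ Δ) ⊩ C
  ⇒-intro⁻¹ ⟨ d ⟩ = ⟨ d ⟩

  closed : ∀ {Δ C} → [] ⊩ C → Δ ⊩ C
  closed {[]} d = d
  closed {H ∷ Δ} {C} d = ⇒-intro⁻¹ (closed {Δ} {H ⇒ C} (⇒-elim₀ K d))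

  ⇒-elim : ∀ {Δ X Y} → Δ ⊩ (X ⇒ Y) → Δ ⊩ X → Δ ⊩ Y
  ⇒-elim {[]} d e = ⇒-elim₀ d e
  ⇒-elim {H ∷ Δ} {X} {Y} d e =
    ⇒-intro⁻¹ (⇒-elim {Δ} (⇒-elim {Δ} (closed (S {H} {X} {Y})) (⇒-intro d)) (⇒-intro e))

  weaken : ∀ {Δ H C} → Δ ⊩ C → (H ∷ Δ) ⊩ C
  weaken d = ⇒-intro⁻¹ (⇒-elim (closed K) d)

  #0 : ∀ {Δ X} → (X ∷ Δ) ⊩ X
  #0 = ⇒-intro⁻¹ (closed I)

  #1 : ∀ {Δ X H₀} → (H₀ ∷ X ∷ Δ) ⊩ X
  #1 = weaken #0

  #2 : ∀ {Δ X H₀ H₁} → (H₀ ∷ H₁ ∷ X ∷ Δ) ⊩ X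
  #2 = weaken #1

  #3 : ∀ {Δ X H₀ H₁ H₂} → (H₀ ∷ H₁ ∷ H₂ ∷ X ∷ Δ) ⊩ X
  #3 = weaken #2

  #4 : ∀ {Δ X H₀ H₁ H₂ H₃} → (H₀ ∷ H₁ ∷ H₂ ∷ H₃ ∷ X ∷ Δ) ⊩ X
  #4 = weaken #3

  pair : ∀ {Δ X Y} → Δ ⊩ X → Δ ⊩ Y → Δ ⊩ (X ∧′ Y)
  pair {X = X} {Y} d e =
    ⇒-elim (⇒-elim (⇒-elim (closed (axiom {(X ⇒ X) ⇒ ((X ⇒ Y) ⇒ (X ⇒ X ∧′ Y))}
                                             (ax6 (f X) (f Y) (f X))))
                            (closed I))
                    (⇒-intro (weaken e)))
           d

  fst : ∀ {Δ X Y} → Δ ⊩ (X ∧′ Y) → Δ ⊩ X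
  fst {X = X} {Y} = ⇒-elim (closed (axiom {X ∧′ Y ⇒ X} (ax4 (f X) (f Y))))

  snd : ∀ {Δ X Y} → Δ ⊩ (X ∧′ Y) → Δ ⊩ Y
  snd {X = X} {Y} = ⇒-elim (closed (axiom {X ∧′ Y ⇒ Y} (ax5 (f X) (f Y))))

  inl : ∀ {Δ X Y} → Δ ⊩ X → Δ ⊩ (X ∨′ Y)
  inl {X = X} {Y} = ⇒-elim (closed (axiom {X ⇒ X ∨′ Y} (ax7 (f X) (f Y))))

  inr : ∀ {Δ X Y} → Δ ⊩ Y → Δ ⊩ (X ∨′ Y)
  inr {X = X} {Y} = ⇒-elim (closed (axiom {Y ⇒ X ∨′ Y} (ax8 (f X) (f Y))))

  case : ∀ {Δ X Y C} → Δ ⊩ (X ∨′ Y) → (X ∷ Δ) ⊩ C → (Y ∷ Δ) ⊩ C → Δ ⊩ C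
  case {X = X} {Y} {C} d e₁ e₂ =
    ⇒-elim (⇒-elim (⇒-elim (closed (axiom {(X ⇒ C) ⇒ ((Y ⇒ C) ⇒ (X ∨′ Y ⇒ C))}
                                             (ax9 (f X) (f Y) (f C))))
                            (⇒-intro e₁))
                    (⇒-intro e₂))
           d

  efq : ∀ {Δ C} → Δ ⊩ ⊥′ → Δ ⊩ C
  efq {C = C} = ⇒-elim (closed (axiom {⊥′ ⇒ C} (ax10 (f C))))

  ∀-intro : ∀ {Δ C} x → All (λ H → ¬ Free x (f H)) Δ → Δ ⊩ C → Δ ⊩ ∀′ x C
  ∀-intro {[]} {C} x [] ⟨ d ⟩ = ⟨ gen x (∀′ x C , refl) d ⟩
  ∀-intro {H ∷ Δ} {C} x (x∉H ∷ x∉Δ) d =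
    ⇒-intro⁻¹ (⇒-elim (closed (axiom {∀′ x (H ⇒ C) ⇒ (H ⇒ ∀′ x C)} (ax13 x (f C) (f H) x∉H)))
                      (∀-intro x x∉Δ (⇒-intro d)))

  ∀-elim : ∀ {Δ} x X → Δ ⊩ ∀′ x X → Δ ⊩ X
  ∀-elim x X = ⇒-elim (closed (axiom {∀′ x X ⇒ X}
    (≡.subst (λ Z → Axiom (∀′ x (f X) ⇒ Z)) (subst-self x (f X))
       (ax14 x (var x) (f X) (freeFor-self x (f X))))))

  ∃-intro : ∀ {Δ} x X → Δ ⊩ X → Δ ⊩ ∃′ x X
  ∃-intro x X = ⇒-elim (closed (axiom {X ⇒ ∃′ x X}
    (≡.subst (λ Z → Axiom (Z ⇒ ∃′ x (f X))) (subst-self x (f X))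
       (ax11 x (var x) (f X) (freeFor-self x (f X))))))

  ∃-elim : ∀ x X C → ¬ Free x (f C) → [] ⊩ (∀′ x (X ⇒ C) ⇒ (∃′ x X ⇒ C))
  ∃-elim x X C x∉C = axiom (ax12 x (f X) (f C) x∉C)

  ¬¬-∀ : ∀ x X → [] ⊩ (∀′ x (¬′ ¬′ X) ⇒ ¬′ ¬′ ∀′ x X)
  ¬¬-∀ x X = axiom (i1 x (f X))

  ⇔-refl : ∀ {X} → [] ⊩ ((X ⇒ X) ∧′ (X ⇒ X))
  ⇔-refl = pair I I

  -- "Y refutes X" (Y ⇒ ¬ X) and "X or Y is decided" (¬¬ (X ∨ Y)) are the
  -- shapes of i2 and i3 once f pushes ∼ inwards.

  refute-swap : ∀ {X Y} → [] ⊩ (Y ⇒ ¬′ X) → [] ⊩ (X ⇒ ¬′ Y)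
  refute-swap r = ⇒-intro (⇒-intro (⇒-elim (⇒-elim (closed r) #0) #1))

  decide-swap : ∀ {X Y} → [] ⊩ ¬′ ¬′ (X ∨′ Y) → [] ⊩ ¬′ ¬′ (Y ∨′ X)
  decide-swap d =
    ⇒-intro (⇒-elim (closed d) (⇒-intro (case #0 (⇒-elim #2 (inr #0)) (⇒-elim #2 (inl #0)))))

  refute-∧ : ∀ {X₁ X₂ Y₁ Y₂} → [] ⊩ (Y₁ ⇒ ¬′ X₁) → [] ⊩ (Y₂ ⇒ ¬′ X₂) →
             [] ⊩ ((Y₁ ∨′ Y₂) ⇒ ¬′ (X₁ ∧′ X₂))
  refute-∧ r₁ r₂ = ⇒-intro (⇒-intro (case #1
    (⇒-elim (⇒-elim (closed r₁) #0) (fst #1))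
    (⇒-elim (⇒-elim (closed r₂) #0) (snd #1))))

  decide-∧ : ∀ {X₁ X₂ Y₁ Y₂} → [] ⊩ ¬′ ¬′ (X₁ ∨′ Y₁) → [] ⊩ ¬′ ¬′ (X₂ ∨′ Y₂) →
             [] ⊩ ¬′ ¬′ ((X₁ ∧′ X₂) ∨′ (Y₁ ∨′ Y₂))
  decide-∧ d₁ d₂ = ⇒-intro (⇒-elim (closed d₁) (⇒-intro (case #0
    (⇒-elim (closed d₂) (⇒-intro (case #0
      (⇒-elim #4 (inl (pair #2 #0)))
      (⇒-elim #4 (inr (inr #0))))))
    (⇒-elim #2 (inr (inl #0))))))

  refute-∨ : ∀ {X₁ X₂ Y₁ Y₂} → [] ⊩ (Y₁ ⇒ ¬′ X₁) → [] ⊩ (Y₂ ⇒ ¬′ X₂) →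
             [] ⊩ ((Y₁ ∧′ Y₂) ⇒ ¬′ (X₁ ∨′ X₂))
  refute-∨ r₁ r₂ = ⇒-intro (⇒-intro (case #0
    (⇒-elim (⇒-elim (closed r₁) (fst #2)) #0)
    (⇒-elim (⇒-elim (closed r₂) (snd #2)) #0)))

  decide-∨ : ∀ {X₁ X₂ Y₁ Y₂} → [] ⊩ ¬′ ¬′ (X₁ ∨′ Y₁) → [] ⊩ ¬′ ¬′ (X₂ ∨′ Y₂) →
             [] ⊩ ¬′ ¬′ ((X₁ ∨′ X₂) ∨′ (Y₁ ∧′ Y₂))
  decide-∨ d₁ d₂ = ⇒-intro (⇒-elim (closed d₁) (⇒-intro (case #0
    (⇒-elim #2 (inl (inl #0)))
    (⇒-elim (closed d₂) (⇒-intro (case #0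
      (⇒-elim #4 (inl (inr #0)))
      (⇒-elim #4 (inr (pair #2 #0)))))))))

  refute-⇒ : ∀ {X₁ X₂ Y₁ Y₂} → [] ⊩ ¬′ ¬′ (X₁ ∨′ Y₁) → [] ⊩ (Y₂ ⇒ ¬′ X₂) →
             [] ⊩ ((¬′ Y₁ ∧′ Y₂) ⇒ ¬′ (X₁ ⇒ X₂))
  refute-⇒ d₁ r₂ = ⇒-intro (⇒-intro (⇒-elim (closed d₁) (⇒-intro (case #0
    (⇒-elim (⇒-elim (closed r₂) (snd #3)) (⇒-elim #2 #0))
    (⇒-elim (fst #3) #0)))))

  decide-⇒ : ∀ {X₁ X₂ Y₁ Y₂} → [] ⊩ (Y₁ ⇒ ¬′ X₁) → [] ⊩ ¬′ ¬′ (X₂ ∨′ Y₂) →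
             [] ⊩ ¬′ ¬′ ((X₁ ⇒ X₂) ∨′ (¬′ Y₁ ∧′ Y₂))
  decide-⇒ r₁ d₂ = ⇒-intro (⇒-elim (closed d₂) (⇒-intro (case #0
    (⇒-elim #2 (inl (⇒-intro #1)))
    (⇒-elim #2 (inr (pair
      (⇒-intro (⇒-elim (⇒-intro (⇒-elim #4 (inl (⇒-intro (efq (⇒-elim #1 #0))))))
                       (⇒-elim (closed r₁) #0)))
      #0))))))

  refute-∀ : ∀ {x X Y} → [] ⊩ (Y ⇒ ¬′ X) → [] ⊩ (∃′ x Y ⇒ ¬′ ∀′ x X)
  refute-∀ {x} {X} {Y} r =
    ⇒-elim (∃-elim x Y (¬′ ∀′ x X) (λ { (f⇒l q) → ∀-binds q ; (f⇒r ()) }))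
           (∀-intro x [] (⇒-intro (⇒-intro (⇒-elim (⇒-elim (closed r) #1) (∀-elim x X #0)))))

  refute-∃ : ∀ {x X Y} → [] ⊩ (Y ⇒ ¬′ X) → [] ⊩ (∀′ x Y ⇒ ¬′ ∃′ x X)
  refute-∃ {x} {X} {Y} r = ⇒-intro (⇒-elim (closed (∃-elim x X ⊥′ (λ ())))
    (∀-intro x (∀-binds ∷ []) (⇒-intro (⇒-elim (⇒-elim (closed r) (∀-elim x Y #1)) #0))))

  decide-∀ : ∀ {x X Y} → [] ⊩ ¬′ ¬′ (X ∨′ Y) → [] ⊩ ¬′ ¬′ (∀′ x X ∨′ ∃′ x Y)
  decide-∀ {x} {X} {Y} d = ⇒-intro (⇒-elim
    (⇒-elim (closed (¬¬-∀ x X)) (∀-intro x (x∉¬∨ ∷ [])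
      (⇒-intro (⇒-elim (closed d) (⇒-intro (case #0
        (⇒-elim #2 #0)
        (⇒-elim #3 (inr (∃-intro x Y #0)))))))))
    (⇒-intro (⇒-elim #1 (inl #0))))
    where
    x∉¬∨ : ¬ Free x (f (¬′ (∀′ x X ∨′ ∃′ x Y)))
    x∉¬∨ (f⇒l (f∨l q)) = ∀-binds q
    x∉¬∨ (f⇒l (f∨r q)) = ∃-binds q

  decide-∃ : ∀ {x X Y} → [] ⊩ ¬′ ¬′ (X ∨′ Y) → [] ⊩ ¬′ ¬′ (∃′ x X ∨′ ∀′ x Y)
  decide-∃ {x} {X} {Y} d = ⇒-intro (⇒-elim
    (⇒-elim (closed (¬¬-∀ x Y)) (∀-intro x (x∉¬∨ ∷ [])
      (⇒-intro (⇒-elim (closed d) (⇒-intro (case #0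
        (⇒-elim #3 (inl (∃-intro x X #0)))
        (⇒-elim #2 #0)))))))
    (⇒-intro (⇒-elim #1 (inr #0))))
    where
    x∉¬∨ : ¬ Free x (f (¬′ (∃′ x X ∨′ ∀′ x Y)))
    x∉¬∨ (f⇒l (f∨l q)) = ∃-binds q
    x∉¬∨ (f⇒l (f∨r q)) = ∀-binds q

  mutual
    i2-f : ∀ A → [] ⊩ (∼ A ⇒ ¬′ A)
    i2-f (pred p ts) = axiom (i2 (pred p ts))
    i2-f ⊥′ = axiom (i2 ⊥′)
    i2-f (∼ A) = retype refl (refute-swap (i2-f A))
    i2-f (A ∧′ B) = retype refl (refute-∧ (i2-f A) (i2-f B))
    i2-f (A ∨′ B) = retype refl (refute-∨ (i2-f A) (i2-f B))
    i2-f (A ⇒ B) = retype refl (refute-⇒ (i3-f A) (i2-f B))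
    i2-f (∀′ x A) = retype refl (refute-∀ (i2-f A))
    i2-f (∃′ x A) = retype refl (refute-∃ (i2-f A))

    i3-f : ∀ A → [] ⊩ ¬′ ¬′ (A ∨′ ∼ A)
    i3-f (pred p ts) = axiom (i3 (pred p ts))
    i3-f ⊥′ = axiom (i3 ⊥′)
    i3-f (∼ A) = retype refl (decide-swap (i3-f A))
    i3-f (A ∧′ B) = retype refl (decide-∧ (i3-f A) (i3-f B))
    i3-f (A ∨′ B) = retype refl (decide-∨ (i3-f A) (i3-f B))
    i3-f (A ⇒ B) = retype refl (decide-⇒ (i2-f A) (i3-f B))
    i3-f (∀′ x A) = retype refl (decide-∀ (i3-f A))
    i3-f (∃′ x A) = retype refl (decide-∃ (i3-f A))

  axiom-f : ∀ {A} → Axiom A → [] ⊩ A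
  axiom-f (ax1 A B) = axiom (ax1 (f A) (f B))
  axiom-f (ax2 A B C) = axiom (ax2 (f A) (f B) (f C))
  axiom-f (ax4 A B) = axiom (ax4 (f A) (f B))
  axiom-f (ax5 A B) = axiom (ax5 (f A) (f B))
  axiom-f (ax6 A B C) = axiom (ax6 (f A) (f B) (f C))
  axiom-f (ax7 A B) = axiom (ax7 (f A) (f B))
  axiom-f (ax8 A B) = axiom (ax8 (f A) (f B))
  axiom-f (ax9 A B C) = axiom (ax9 (f A) (f B) (f C))
  axiom-f (ax10 A) = axiom (ax10 (f A))
  axiom-f (ax11 x t A ok) = axiom
    (≡.subst (λ Z → Axiom (Z ⇒ ∃′ x (f A))) (sym (f-subst x t A))
       (ax11 x t (f A) (freeFor⇒freeFor-f A ok)))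
  axiom-f (ax12 x A B x∉B) = axiom (ax12 x (f A) (f B) (λ q → x∉B (free-f⇒free B q)))
  axiom-f (ax13 x A B x∉B) = axiom (ax13 x (f A) (f B) (λ q → x∉B (free-f⇒free B q)))
  axiom-f (ax14 x t A ok) = axiom
    (≡.subst (λ Z → Axiom (∀′ x (f A) ⇒ Z)) (sym (f-subst x t A))
       (ax14 x t (f A) (freeFor⇒freeFor-f A ok)))
  axiom-f (ax15 A) = axiom (ax15 (f A))
  axiom-f (ax16 A) = retype refl (⇔-refl {A})
  axiom-f (ax17 A B) = retype refl (⇔-refl {∼ A ∨′ ∼ B})
  axiom-f (ax18 A B) = retype refl (⇔-refl {∼ A ∧′ ∼ B})
  axiom-f (ax19 A B) = retype refl (⇔-refl {¬′ ∼ A ∧′ ∼ B})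
  axiom-f (ax20 x A) = retype refl (⇔-refl {∃′ x (∼ A)})
  axiom-f (ax21 x A) = retype refl (⇔-refl {∀′ x (∼ A)})
  axiom-f (i1 x A) = axiom (i1 x (f A))
  axiom-f (i2 A) = i2-f A
  axiom-f (i3 A) = i3-f A

translate : ∀ {Γ A} → Γ ⊢i3 A → fImage Γ ⊢r f A
translate {A = A} (hyp _ A∈Γ) = hyp (A , refl) (A , A∈Γ , refl)
translate {Γ} (ax _ a) = derivation (axiom-f a) where open ReducedCalculus (fImage Γ)
translate {A = B} (mp _ d e) = mp (B , refl) (translate d) (translate e)
translate {A = ∀′ x A} (gen x _ d) = gen x (∀′ x A , refl) (translate d)

proposition3p5 : (Γ : Form → Set) (A : Form) → Γ ⊢i3 A → fImage Γ ⊢r f A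
proposition3p5 Γ A = translate
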